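{- Let $(\mathcal{P},\preceq)$ be a finite poset with elements $x_1,\dots,x_n$, and let $Z\in\{0,1\}^{n\times n}$ be its zeta matrix, $Z_{ij}=1$ if $x_j\preceq x_i$ and $Z_{ij}=0$ otherwise. Let $\{\mathcal{Z}_1,\dots,\mathcal{Z}_k\}$ be a chain decomposition of $\mathcal{P}$. For $x\in\mathcal{P}$ and $1\le q\le k$, whenever $\{y\in\mathcal{P}: y\preceq x\}\cap\mathcal{Z}_q\neq\emptyset$ let $\textit{niv}_q(x)$ denote the maximum (with respect to $\preceq$) of this set, and let $\textit{niv}(x)$ be the set of all such defined values $\textit{niv}_q(x)$, $1\le q\le k$. Define $U\in\{0,1\}^{n\times n}$ by $U_{ij}=1$ iff $x_j\in\textit{niv}(x_i)$, and $V\in\{0,1\}^{n\times n}$ by $V_{ij}=1$ iff $x_i$ and $x_j$ lie in the same chain $\mathcal{Z}_q$ and $x_j\preceq x_i$. Then $Z=UV$. Moreover, $V=P^{ -1}BP$ for some permutation matrix $P$ and a block-diagonal matrix $B$ whose diagonal blocks are the zeta matrices of the chains $\mathcal{Z}_1,\dots,\mathcal{Z}_k$ (each an upper triangular all-ones matrix).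
   Context: A chain decomposition of a finite poset $\mathcal{P}$ is a partition $\{\mathcal{Z}_1,\dots,\mathcal{Z}_k\}$ of $\mathcal{P}$ into totally ordered subsets (chains). The zeta transform of a function $f:\mathcal{P}\to\mathbb{R}$ (viewed as a vector indexed by $x_1,\dots,x_n$) is $g=Zf$, i.e. $g(x)=\sum_{y\preceq x}f(y)$. -}

module Defs where

open import Level using (0ℓ)
open import Data.Nat using (ℕ; zero; suc; _+_; _*_)
open import Data.Fin using (Fin; zero; suc; _≟_; _≤_)
open import Data.Fin.Properties using (all?; any?)
open import Data.Fin.Permutation using (Permutation′; _⟨$⟩ʳ_; _⟨$⟩ˡ_)
open import Data.Product using (_×_; ∃; Σ; _,_)
open import Data.Sum using (_⊎_)
open import Relation.Binary.Core using (Rel)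
open import Relation.Binary.Structures using (IsDecPartialOrder)
open import Relation.Binary.PropositionalEquality using (_≡_)
open import Relation.Nullary using (Dec; yes; no)
open import Relation.Nullary.Decidable using (_×-dec_)
open import Function using (Surjective)

-- Square ℕ-valued matrices indexed by Fin n (entries will be 0/1;
-- products over ℕ agree with products over ℝ).
Matrix : ℕ → Set
Matrix n = Fin n → Fin n → ℕ

∑ : ∀ {n} → (Fin n → ℕ) → ℕ
∑ {zero}  f = 0
∑ {suc n} f = f zero + ∑ (λ i → f (suc i))

_⊗_ : ∀ {n} → Matrix n → Matrix n → Matrix n
(A ⊗ B) i j = ∑ (λ l → A i l * B l j)

⟦_⟧ : ∀ {a} {A : Set a} → Dec A → ℕ
⟦ yes _ ⟧ = 1
⟦ no  _ ⟧ = 0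

module _ {n : ℕ} {_≼_ : Rel (Fin n) 0ℓ}
         (po : IsDecPartialOrder _≡_ _≼_) where
  open IsDecPartialOrder po using (_≤?_)

  zeta : Matrix n
  zeta i j = ⟦ j ≤? i ⟧

  -- c : Fin n → Fin k assigns every element to its chain; the chains
  -- Z_q = c⁻¹(q) form a chain decomposition: they partition P (automatic
  -- for a function c), every block is nonempty (c surjective) and every
  -- block is totally ordered.
  IsChainDecomposition : ∀ {k} → (Fin n → Fin k) → Set
  IsChainDecomposition c =
    Surjective _≡_ _≡_ c ×
    (∀ i j → c i ≡ c j → (i ≼ j) ⊎ (j ≼ i))

  module _ {k : ℕ} (c : Fin n → Fin k) where
    IsNiv : Fin k → Fin n → Fin n → Set
    IsNiv q x y = (y ≼ x × c y ≡ q) × (∀ z → (z ≼ x × c z ≡ q) → z ≼ y)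

    isNiv? : ∀ q x y → Dec (IsNiv q x y)
    isNiv? q x y =
      ((y ≤? x) ×-dec (c y ≟ q)) ×-dec
      all? (λ z → decImpl ((z ≤? x) ×-dec (c z ≟ q)) (z ≤? y))
      where
      decImpl : ∀ {A B : Set} → Dec A → Dec B → Dec (A → B)
      decImpl _       (yes b) = yes (λ _ → b)
      decImpl (no ¬a) (no _)  = yes (λ a → Data.Empty.⊥-elim (¬a a))
        where import Data.Empty
      decImpl (yes a) (no ¬b) = no (λ f → ¬b (f a))

    Umat : Matrix n
    Umat i j = ⟦ any? (λ q → isNiv? q i j) ⟧

    Vmat : Matrix n
    Vmat i j = ⟦ (c i ≟ c j) ×-dec (j ≤? i) ⟧

-- permutation matrix of σ : P a b = 1 iff σ(a) = b;
-- its inverse is the permutation matrix of σ⁻¹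
permMatrix : ∀ {n} → Permutation′ n → Matrix n
permMatrix σ a b = ⟦ (σ ⟨$⟩ʳ a) ≟ b ⟧

permMatrixInv : ∀ {n} → Permutation′ n → Matrix n
permMatrixInv σ a b = ⟦ (σ ⟨$⟩ˡ a) ≟ b ⟧

-- B is block diagonal with blocks Z_1,…,Z_k (in this order, contiguous),
-- the block of B-index a being blk a, and each diagonal block is the
-- zeta matrix of a chain listed in decreasing order, i.e. an upper
-- triangular all-ones matrix.
IsBlockDiagOfChainZetas : ∀ {n k} → (blk : Fin n → Fin k) → Matrix n → Set
IsBlockDiagOfChainZetas blk B =
  (∀ a b → a ≤ b → blk a ≤ blk b) ×
  (∀ a b → blk a ≡ blk b → B a b ≡ ⟦ Data.Fin._≤?_ a b ⟧) ×
  (∀ a b → (blk a ≡ blk b → Data.Empty.⊥) → B a b ≡ 0)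
  where import Data.Empty

-- Z = UV: the summand U(x, l) V(l, y) of (UV)(x, y) is nonzero exactly when
-- l = niv_q(x) for the chain q of y and y ≼ l.  If y ⋠ x there is no such l,
-- as y ≼ l ≼ x; if y ≼ x, then niv_q(x) exists, is unique, and lies above y
-- since y belongs to the set of which it is the maximum.
--
-- V = P⁻¹BP: order the elements first by chain and, inside a chain, in
-- decreasing ≼-order.  This is a strict total order, so ranking the
-- elements by it is a permutation, and after this relabelling V becomes
-- block diagonal with upper triangular all-ones blocks.
module Submission where

open import Defs
open import Level using (0ℓ)
open import Data.Nat using (ℕ; zero; suc; _*_; _+_; _≤_; _<_; z≤n; s≤s)
import Data.Nat.Properties as ℕ
open import Data.Fin as Fin using (Fin; zero; suc; fromℕ<; punchOut)
import Data.Fin.Properties as Fin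
open import Data.Fin.Permutation using (Permutation′; permutation; _⟨$⟩ʳ_; _⟨$⟩ˡ_; inverseˡ; inverseʳ)
open import Data.Product using (_×_; Σ; _,_; proj₁; proj₂)
open import Data.Sum using (_⊎_; inj₁; inj₂)
open import Function using (_∘_)
open import Function.Definitions using (Injective; StrictlySurjective)
open import Relation.Nullary using (Dec; yes; no; ¬_; contradiction)
open import Relation.Nullary.Decidable using (_×-dec_)
open import Relation.Unary using (Pred)
open import Relation.Binary.Core using (Rel)
open import Relation.Binary.Definitions using (Trichotomous; tri<; tri≈; tri>)
open import Relation.Binary.Structures using (IsPreorder; IsDecPartialOrder; IsStrictPartialOrder; IsStrictTotalOrder)
open import Relation.Binary.PropositionalEquality
  using (_≡_; _≢_; refl; sym; trans; cong; cong₂; subst; subst₂; resp₂; isEquivalence)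

∑-zero : ∀ {n} {f : Fin n → ℕ} → (∀ l → f l ≡ 0) → ∑ f ≡ 0
∑-zero {zero}  f≡0 = refl
∑-zero {suc n} f≡0 = cong₂ _+_ (f≡0 zero) (∑-zero (f≡0 ∘ suc))

∑-kronecker : ∀ {n} {f : Fin n → ℕ} (a : Fin n) → (∀ l → l ≢ a → f l ≡ 0) → ∑ f ≡ f a
∑-kronecker {suc n} {f} zero    f≡0 =
  trans (cong (f zero +_) (∑-zero (λ l → f≡0 (suc l) λ ()))) (ℕ.+-identityʳ (f zero))
∑-kronecker {suc n} {f} (suc a) f≡0 =
  cong₂ _+_ (f≡0 zero λ ()) (∑-kronecker a (λ l l≢a → f≡0 (suc l) (l≢a ∘ Fin.suc-injective)))

∑-mono-≤ : ∀ {n} {f g : Fin n → ℕ} → (∀ l → f l ≤ g l) → ∑ f ≤ ∑ g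
∑-mono-≤ {zero}  f≤g = z≤n
∑-mono-≤ {suc n} f≤g = ℕ.+-mono-≤ (f≤g zero) (∑-mono-≤ (f≤g ∘ suc))

∑-mono-< : ∀ {n} {f g : Fin n → ℕ} → (∀ l → f l ≤ g l) → (a : Fin n) → f a < g a → ∑ f < ∑ g
∑-mono-< {suc n} f≤g zero    fa<ga = ℕ.+-mono-<-≤ fa<ga (∑-mono-≤ (f≤g ∘ suc))
∑-mono-< {suc n} f≤g (suc a) fa<ga = ℕ.+-mono-≤-< (f≤g zero) (∑-mono-< (f≤g ∘ suc) a fa<ga)

∑-const-1 : ∀ n → ∑ {n} (λ _ → 1) ≡ n
∑-const-1 zero    = refl
∑-const-1 (suc n) = cong suc (∑-const-1 n)

⟦⟧-≡1 : ∀ {A : Set} (d : Dec A) → A → ⟦ d ⟧ ≡ 1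
⟦⟧-≡1 (yes _) _ = refl
⟦⟧-≡1 (no ¬a) a = contradiction a ¬a

⟦⟧-≡0 : ∀ {A : Set} (d : Dec A) → ¬ A → ⟦ d ⟧ ≡ 0
⟦⟧-≡0 (yes a) ¬a = contradiction a ¬a
⟦⟧-≡0 (no _)  _  = refl

⟦⟧-≤1 : ∀ {A : Set} (d : Dec A) → ⟦ d ⟧ ≤ 1
⟦⟧-≤1 (yes _) = s≤s z≤n
⟦⟧-≤1 (no _)  = z≤n

⟦⟧-cong : ∀ {A B : Set} (d : Dec A) (e : Dec B) → (A → B) → (B → A) → ⟦ d ⟧ ≡ ⟦ e ⟧
⟦⟧-cong (yes a) e A→B B→A = sym (⟦⟧-≡1 e (A→B a))
⟦⟧-cong (no ¬a) e A→B B→A = sym (⟦⟧-≡0 e (¬a ∘ B→A))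

permMatrixInv-⊗ : ∀ {n} (σ : Permutation′ n) (A : Matrix n) i b →
  (permMatrixInv σ ⊗ A) i b ≡ A (σ ⟨$⟩ˡ i) b
permMatrixInv-⊗ σ A i b = trans (∑-kronecker (σ ⟨$⟩ˡ i) off-row) on-row
  where
  off-row : ∀ a → a ≢ σ ⟨$⟩ˡ i → ⟦ σ ⟨$⟩ˡ i Fin.≟ a ⟧ * A a b ≡ 0
  off-row a a≢ = cong (_* A a b) (⟦⟧-≡0 (σ ⟨$⟩ˡ i Fin.≟ a) (a≢ ∘ sym))
  on-row : ⟦ σ ⟨$⟩ˡ i Fin.≟ σ ⟨$⟩ˡ i ⟧ * A (σ ⟨$⟩ˡ i) b ≡ A (σ ⟨$⟩ˡ i) b
  on-row = trans (cong (_* A (σ ⟨$⟩ˡ i) b) (⟦⟧-≡1 (σ ⟨$⟩ˡ i Fin.≟ σ ⟨$⟩ˡ i) refl)) (ℕ.*-identityˡ _)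

⊗-permMatrix : ∀ {n} (σ : Permutation′ n) (A : Matrix n) a j →
  (A ⊗ permMatrix σ) a j ≡ A a (σ ⟨$⟩ˡ j)
⊗-permMatrix σ A a j = trans (∑-kronecker (σ ⟨$⟩ˡ j) off-column) on-column
  where
  off-column : ∀ b → b ≢ σ ⟨$⟩ˡ j → A a b * ⟦ σ ⟨$⟩ʳ b Fin.≟ j ⟧ ≡ 0
  off-column b b≢ = trans (cong (A a b *_) (⟦⟧-≡0 (σ ⟨$⟩ʳ b Fin.≟ j) λ { refl → b≢ (sym (inverseˡ σ)) }))
                          (ℕ.*-zeroʳ (A a b))
  on-column : A a (σ ⟨$⟩ˡ j) * ⟦ σ ⟨$⟩ʳ (σ ⟨$⟩ˡ j) Fin.≟ j ⟧ ≡ A a (σ ⟨$⟩ˡ j)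
  on-column = trans (cong (A a (σ ⟨$⟩ˡ j) *_) (⟦⟧-≡1 (σ ⟨$⟩ʳ (σ ⟨$⟩ˡ j) Fin.≟ j) (inverseʳ σ)))
                    (ℕ.*-identityʳ _)

permMatrix-conjugate : ∀ {n} (σ : Permutation′ n) (A : Matrix n) i j →
  (permMatrixInv σ ⊗ (A ⊗ permMatrix σ)) i j ≡ A (σ ⟨$⟩ˡ i) (σ ⟨$⟩ˡ j)
permMatrix-conjugate σ A i j =
  trans (permMatrixInv-⊗ σ (A ⊗ permMatrix σ) i j) (⊗-permMatrix σ A (σ ⟨$⟩ˡ i) j)

Fin-injective⇒surjective : ∀ {n} {f : Fin n → Fin n} → Injective _≡_ _≡_ f → StrictlySurjective _≡_ f
Fin-injective⇒surjective {suc m} {f} f-inj y with Fin.any? (λ x → f x Fin.≟ y)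
... | yes hit  = hit
... | no  miss = contradiction (Fin.injective⇒≤ squeeze-injective) ℕ.1+n≰n
  where
  -- if f misses y, it injects Fin (suc m) into the remaining m elements
  squeeze : Fin (suc m) → Fin m
  squeeze x = punchOut {i = y} (λ y≡fx → miss (x , sym y≡fx))
  squeeze-injective : Injective _≡_ _≡_ squeeze
  squeeze-injective {x} {x′} = f-inj ∘ Fin.punchOut-injective {i = y} {j = f x} {k = f x′} _ _

module Ranking {n} {_⊏_ : Rel (Fin n) 0ℓ} (sto : IsStrictTotalOrder _≡_ _⊏_) where
  open IsStrictTotalOrder sto using (_<?_; irrefl; compare) renaming (trans to ⊏-trans)

  height : Fin n → ℕ
  height i = ∑ (λ j → ⟦ j <? i ⟧)

  ⊏⇒height< : ∀ {i j} → i ⊏ j → height i < height j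
  ⊏⇒height< {i} {j} i⊏j = ∑-mono-< below-i⇒below-j i i-counted-once
    where
    below-i⇒below-j : ∀ l → ⟦ l <? i ⟧ ≤ ⟦ l <? j ⟧
    below-i⇒below-j l with l <? i
    ... | no _    = z≤n
    ... | yes l⊏i = ℕ.≤-reflexive (sym (⟦⟧-≡1 (l <? j) (⊏-trans l⊏i i⊏j)))
    i-counted-once : ⟦ i <? i ⟧ < ⟦ i <? j ⟧
    i-counted-once rewrite ⟦⟧-≡0 (i <? i) (irrefl refl) | ⟦⟧-≡1 (i <? j) i⊏j = ℕ.≤-refl

  height<n : ∀ i → height i < n
  height<n i = subst (height i <_) (∑-const-1 n)
    (∑-mono-< (λ l → ⟦⟧-≤1 (l <? i)) i
      (subst (_< 1) (sym (⟦⟧-≡0 (i <? i) (irrefl refl))) ℕ.≤-refl))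

  rank : Fin n → Fin n
  rank i = fromℕ< (height<n i)

  ⊏⇒rank< : ∀ {i j} → i ⊏ j → rank i Fin.< rank j
  ⊏⇒rank< {i} {j} i⊏j =
    subst₂ _<_ (sym (Fin.toℕ-fromℕ< (height<n i))) (sym (Fin.toℕ-fromℕ< (height<n j))) (⊏⇒height< i⊏j)

  rank≤⇒⊀ : ∀ {i j} → rank i Fin.≤ rank j → ¬ (j ⊏ i)
  rank≤⇒⊀ ri≤rj j⊏i = ℕ.<⇒≱ (⊏⇒rank< j⊏i) ri≤rj

  rank-injective : Injective _≡_ _≡_ rank
  rank-injective {i} {j} ri≡rj with compare i j
  ... | tri< i⊏j _ _ = contradiction ri≡rj (Fin.<⇒≢ (⊏⇒rank< i⊏j))
  ... | tri≈ _ i≡j _ = i≡j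
  ... | tri> _ _ j⊏i = contradiction (sym ri≡rj) (Fin.<⇒≢ (⊏⇒rank< j⊏i))

  unrank : Fin n → Fin n
  unrank a = proj₁ (Fin-injective⇒surjective rank-injective a)

  rank-unrank : ∀ a → rank (unrank a) ≡ a
  rank-unrank a = proj₂ (Fin-injective⇒surjective rank-injective a)

  unrank-rank : ∀ i → unrank (rank i) ≡ i
  unrank-rank i = rank-injective (rank-unrank (rank i))

  unranking : Permutation′ n
  unranking = permutation unrank rank unrank-rank rank-unrank

module ChainMaximum {n} {_≼_ : Rel (Fin n) 0ℓ} (pre : IsPreorder _≡_ _≼_)
    {P : Pred (Fin n) 0ℓ} (P? : ∀ x → Dec (P x))
    (P-chain : ∀ {a b} → P a → P b → (a ≼ b) ⊎ (b ≼ a)) where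
  open IsPreorder pre using () renaming (refl to ≼-refl; trans to ≼-trans)

  MaximumOn : ∀ {m} → (Fin m → Fin n) → Set
  MaximumOn g = Σ (Fin n) λ y → P y × (∀ t → P (g t) → g t ≼ y)

  maximumOn : ∀ {m} (g : Fin m → Fin n) → MaximumOn g ⊎ (∀ t → ¬ P (g t))
  maximumOn {zero}  g = inj₂ λ ()
  maximumOn {suc m} g with P? (g zero) | maximumOn (g ∘ suc)
  ... | no ¬p | inj₁ (y , py , max) = inj₁ (y , py , λ { zero p → contradiction p ¬p ; (suc t) → max t })
  ... | no ¬p | inj₂ none           = inj₂ λ { zero → ¬p ; (suc t) → none t }
  ... | yes p | inj₂ none           = inj₁ (g zero , p , λ { zero _ → ≼-refl ; (suc t) q → contradiction q (none t) })
  ... | yes p | inj₁ (y , py , max) with P-chain p py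
  ...   | inj₁ g₀≼y = inj₁ (y , py , λ { zero _ → g₀≼y ; (suc t) → max t })
  ...   | inj₂ y≼g₀ = inj₁ (g zero , p , λ { zero _ → ≼-refl ; (suc t) q → ≼-trans (max t q) y≼g₀ })

  maximum : ∀ {x} → P x → MaximumOn (λ z → z)
  maximum {x} px with maximumOn (λ z → z)
  ... | inj₁ max  = max
  ... | inj₂ none = contradiction px (none x)

module ChainDecomposition {n k} {_≼_ : Rel (Fin n) 0ℓ} (po : IsDecPartialOrder _≡_ _≼_)
    (c : Fin n → Fin k) (chains : ∀ i j → c i ≡ c j → (i ≼ j) ⊎ (j ≼ i)) where
  open IsDecPartialOrder po using (_≤?_; antisym; isPreorder) renaming (refl to ≼-refl; trans to ≼-trans)

  U V : Matrix n
  U = Umat po c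
  V = Vmat po c

  niv-exists : ∀ {q x z} → z ≼ x → c z ≡ q → Σ (Fin n) (IsNiv po c q x)
  niv-exists {q} {x} {z} z≼x cz≡q = maximum (z≼x , cz≡q)
    where
    open ChainMaximum isPreorder (λ y → (y ≤? x) ×-dec (c y Fin.≟ q))
      (λ (_ , ca≡q) (_ , cb≡q) → chains _ _ (trans ca≡q (sym cb≡q)))

  niv-unique : ∀ {q x y y′} → IsNiv po c q x y → IsNiv po c q x y′ → y ≡ y′
  niv-unique (below , max) (below′ , max′) = antisym (max′ _ below) (max _ below′)

  UV-support : ∀ i j l → ¬ (IsNiv po c (c j) i l × j ≼ l) → U i l * V l j ≡ 0
  UV-support i j l outside with Fin.any? (λ q → isNiv? po c q i l) | (c l Fin.≟ c j) ×-dec (j ≤? l)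
  ... | no _ | _    = refl
  ... | yes _ | no _ = refl
  ... | yes (q , niv@((_ , cl≡q) , _)) | yes (cl≡cj , j≼l) =
    contradiction (subst (λ r → IsNiv po c r i l) (trans (sym cl≡q) cl≡cj) niv , j≼l) outside

  zeta≡UV : ∀ i j → zeta po i j ≡ (U ⊗ V) i j
  zeta≡UV i j with j ≤? i
  ... | no j⋠i = sym (∑-zero λ l → UV-support i j l λ (((l≼i , _) , _) , j≼l) → j⋠i (≼-trans j≼l l≼i))
  ... | yes j≼i with niv-exists j≼i refl
  ...   | y , niv@((_ , cy≡cj) , max) = sym (trans
          (∑-kronecker y (λ l l≢y → UV-support i j l λ (nivₗ , _) → l≢y (niv-unique nivₗ niv)))
          (cong₂ _*_ (⟦⟧-≡1 (Fin.any? (λ q → isNiv? po c q i y)) (c j , niv))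
                     (⟦⟧-≡1 ((c y Fin.≟ c j) ×-dec (j ≤? y)) (cy≡cj , max j (j≼i , refl)))))

  _⊏_ : Rel (Fin n) 0ℓ
  i ⊏ j = (c i Fin.< c j) ⊎ ((c i ≡ c j) × (j ≼ i) × (i ≢ j))

  ⊏-irrefl : ∀ {i j} → i ≡ j → ¬ (i ⊏ j)
  ⊏-irrefl refl (inj₁ ci<ci)          = ℕ.<-irrefl refl ci<ci
  ⊏-irrefl refl (inj₂ (_ , _ , i≢i)) = i≢i refl

  ⊏-trans : ∀ {i j l} → i ⊏ j → j ⊏ l → i ⊏ l
  ⊏-trans (inj₁ ci<cj)               (inj₁ cj<cl)               = inj₁ (ℕ.<-trans ci<cj cj<cl)
  ⊏-trans (inj₁ ci<cj)               (inj₂ (cj≡cl , _ , _))     = inj₁ (subst (c _ Fin.<_) cj≡cl ci<cj)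
  ⊏-trans (inj₂ (ci≡cj , _ , _))     (inj₁ cj<cl)               = inj₁ (subst (Fin._< c _) (sym ci≡cj) cj<cl)
  ⊏-trans (inj₂ (ci≡cj , j≼i , i≢j)) (inj₂ (cj≡cl , l≼j , _)) =
    inj₂ (trans ci≡cj cj≡cl , ≼-trans l≼j j≼i , λ { refl → i≢j (antisym l≼j j≼i) })

  ⊏-connected : ∀ i j → i ≢ j → (i ⊏ j) ⊎ (j ⊏ i)
  ⊏-connected i j i≢j with Fin.<-cmp (c i) (c j)
  ... | tri< ci<cj _ _ = inj₁ (inj₁ ci<cj)
  ... | tri> _ _ cj<ci = inj₂ (inj₁ cj<ci)
  ... | tri≈ _ ci≡cj _ with chains i j ci≡cj
  ...   | inj₁ i≼j = inj₂ (inj₂ (sym ci≡cj , i≼j , i≢j ∘ sym))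
  ...   | inj₂ j≼i = inj₁ (inj₂ (ci≡cj , j≼i , i≢j))

  ⊏-isStrictPartialOrder : IsStrictPartialOrder _≡_ _⊏_
  ⊏-isStrictPartialOrder = record
    { isEquivalence = isEquivalence
    ; irrefl        = ⊏-irrefl
    ; trans         = ⊏-trans
    ; <-resp-≈      = resp₂ _⊏_
    }

  open IsStrictPartialOrder ⊏-isStrictPartialOrder using () renaming (asym to ⊏-asym)

  ⊏-compare : Trichotomous _≡_ _⊏_
  ⊏-compare i j with i Fin.≟ j
  ... | yes i≡j = tri≈ (⊏-irrefl i≡j) i≡j (⊏-irrefl (sym i≡j))
  ... | no i≢j with ⊏-connected i j i≢j
  ...   | inj₁ i⊏j = tri< i⊏j i≢j (⊏-asym i⊏j)
  ...   | inj₂ j⊏i = tri> (⊏-asym j⊏i) i≢j j⊏i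

  ⊏-isStrictTotalOrder : IsStrictTotalOrder _≡_ _⊏_
  ⊏-isStrictTotalOrder = record
    { isStrictPartialOrder = ⊏-isStrictPartialOrder
    ; compare              = ⊏-compare
    }

  open Ranking ⊏-isStrictTotalOrder public

  ≽⇒rank≤ : ∀ {i j} → c i ≡ c j → j ≼ i → rank i Fin.≤ rank j
  ≽⇒rank≤ {i} {j} ci≡cj j≼i with i Fin.≟ j
  ... | yes refl = ℕ.≤-refl
  ... | no i≢j   = ℕ.<⇒≤ (⊏⇒rank< (inj₂ (ci≡cj , j≼i , i≢j)))

  rank≤⇒≽ : ∀ {i j} → c i ≡ c j → rank i Fin.≤ rank j → j ≼ i
  rank≤⇒≽ {i} {j} ci≡cj ri≤rj with chains i j ci≡cj | i Fin.≟ j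
  ... | inj₂ j≼i | _        = j≼i
  ... | inj₁ _   | yes refl = ≼-refl
  ... | inj₁ i≼j | no i≢j   = contradiction (inj₂ (sym ci≡cj , i≼j , i≢j ∘ sym)) (rank≤⇒⊀ ri≤rj)

  blk : Fin n → Fin k
  blk a = c (unrank a)

  blk-rank : ∀ i → blk (rank i) ≡ c i
  blk-rank i = cong c (unrank-rank i)

  blk-mono : ∀ a b → a Fin.≤ b → blk a Fin.≤ blk b
  blk-mono a b a≤b with blk a Fin.≤? blk b
  ... | yes blka≤blkb = blka≤blkb
  ... | no  blka≰blkb = contradiction a≤b (ℕ.<⇒≱ b<a)
    where
    b<a : b Fin.< a
    b<a = subst₂ Fin._<_ (rank-unrank b) (rank-unrank a) (⊏⇒rank< (inj₁ (ℕ.≰⇒> blka≰blkb)))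

  B : Matrix n
  B a b = ⟦ (blk a Fin.≟ blk b) ×-dec (a Fin.≤? b) ⟧

  B-isBlockDiagonal : IsBlockDiagOfChainZetas blk B
  B-isBlockDiagonal = blk-mono
                    , (λ a b same → ⟦⟧-cong _ _ proj₂ (same ,_))
                    , (λ a b different → ⟦⟧-≡0 _ (different ∘ proj₁))

  V≡B∘rank : ∀ i j → V i j ≡ B (rank i) (rank j)
  V≡B∘rank i j = ⟦⟧-cong _ _
    (λ (ci≡cj , j≼i) → chain-of-ranks ci≡cj , ≽⇒rank≤ ci≡cj j≼i)
    (λ (same , ri≤rj) → let ci≡cj = chain-of-elements same in ci≡cj , rank≤⇒≽ ci≡cj ri≤rj)
    where
    chain-of-ranks : c i ≡ c j → blk (rank i) ≡ blk (rank j)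
    chain-of-ranks ci≡cj = trans (blk-rank i) (trans ci≡cj (sym (blk-rank j)))
    chain-of-elements : blk (rank i) ≡ blk (rank j) → c i ≡ c j
    chain-of-elements same = trans (sym (blk-rank i)) (trans same (blk-rank j))

mainTheorem1 : ∀ {n k : ℕ} {_≼_ : Rel (Fin n) 0ℓ}
    (po : IsDecPartialOrder _≡_ _≼_) (c : Fin n → Fin k) →
    IsChainDecomposition po c →
    (∀ i j → zeta po i j ≡ (Umat po c ⊗ Vmat po c) i j) ×
    Σ (Permutation′ n) (λ σ → Σ (Fin n → Fin k) (λ blk → Σ (Matrix n) (λ B →
      IsBlockDiagOfChainZetas blk B ×
      (∀ i → blk (σ ⟨$⟩ˡ i) ≡ c i) ×
      (∀ i j → Vmat po c i j ≡ (permMatrixInv σ ⊗ (B ⊗ permMatrix σ)) i j))))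
mainTheorem1 po c (_ , chains) =
  zeta≡UV , unranking , blk , B , B-isBlockDiagonal , blk-rank ,
  λ i j → trans (V≡B∘rank i j) (sym (permMatrix-conjugate unranking B i j))
  where open ChainDecomposition po c chains
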